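{- Let $n\ge1$ and let $\alpha\in S_1\times S_{n-1}$ be $312$-avoiding. Then $$\mathrm{Inv}(\alpha)=\{(i,j)\ :\ 2\le i\le n,\ j\le n,\ j=t_\alpha^k(i)\text{ for some }k\ge1\},$$ where $t_\alpha^k$ denotes the $k$-fold iterate of $t_\alpha$.
   Context: $S_1\times S_{n-1}$ denotes the set of permutations $\alpha$ of $\{1,\dots,n\}$ with $\alpha(1)=1$, in one-line notation. An inversion of $\alpha$ is a pair of positions $(i,j)$ with $i<j$ and $\alpha(i)>\alpha(j)$; $\mathrm{Inv}(\alpha)$ is the set of inversions. The first inversion function $t_\alpha:\{2,\dots,n+1\}\to\{2,\dots,n+1\}$ is given by $t_\alpha(n+1)=n+1$ and, for $2\le i\le n$, $t_\alpha(i)=j$ where $j$ is the smallest index with $(i,j)\in\mathrm{Inv}(\alpha)$, and $t_\alpha(i)=n+1$ if there is no inversion $(i,j)$. $\alpha$ is $312$-avoiding if there are no positions $i<j<k$ with $\alpha(i),\alpha(j),\alpha(k)$ in the same relative order as $3,1,2$. -}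

module Defs where

open import Data.Nat using (ℕ; zero; suc; _+_; _∸_; _≤_; _<_; _<?_)
open import Data.Fin using (Fin; toℕ; fromℕ<)
open import Data.Fin.Permutation using (Permutation′; _⟨$⟩ʳ_)
open import Data.Product using (_×_; ∃-syntax)
open import Relation.Nullary using (¬_; yes; no)
open import Relation.Binary.PropositionalEquality using (_≡_)

-- Convention: a permutation α of {1,…,n} is given by a stdlib permutation
-- π : Permutation′ n of Fin n = {0,…,n-1}, via α(k) = 1 + π(k-1) for 1 ≤ k ≤ n.
-- `val π k` is α(k) for positions k ∈ {1,…,n} (1-based), and 0 outside.
val : ∀ {n} → Permutation′ n → ℕ → ℕ
val {n} π zero = 0
val {n} π (suc k) with k <? n
... | yes p = suc (toℕ (π ⟨$⟩ʳ fromℕ< p))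
... | no _  = 0

-- α ∈ S₁ × S_{n-1}: α(1) = 1
FixesOne : ∀ {n} → Permutation′ n → Set
FixesOne π = val π 1 ≡ 1

Inv : ∀ {n} → Permutation′ n → ℕ → ℕ → Set
Inv {n} π i j = 1 ≤ i × i < j × j ≤ n × val π j < val π i

Avoids312 : ∀ {n} → Permutation′ n → Set
Avoids312 {n} π =
  ¬ (∃[ i ] ∃[ j ] ∃[ k ]
       (1 ≤ i × i < j × j < k × k ≤ n × val π j < val π k × val π k < val π i))

firstBelow : ∀ {n} → Permutation′ n → ℕ → (fuel : ℕ) → ℕ → ℕ
firstBelow {n} π v zero l = suc n
firstBelow {n} π v (suc fuel) l with val π l <? v
... | yes _ = l
... | no _  = firstBelow π v fuel (suc l)

-- first inversion function t_α : {2,…,n+1} → {2,…,n+1}: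
-- t(i) = least j with (i , j) ∈ Inv(α), or n+1 if none; t(n+1) = n+1.
-- (Defined on all of ℕ; only its values on {2,…,n+1} matter.)
t : ∀ {n} → Permutation′ n → ℕ → ℕ
t {n} π i with i <? suc n
... | yes _ = firstBelow π (val π i) (n ∸ i) (suc i)
... | no _  = suc n

iter : (ℕ → ℕ) → ℕ → ℕ → ℕ
iter f zero x = x
iter f (suc k) x = f (iter f k x)

{-# OPTIONS --safe #-}
module Submission where

-- The first inversion t(i) of i is an inversion partner, and Inv is transitive,
-- so every iterate t^k(i) ≤ n is an inversion partner of i.  Conversely, let
-- (i , j) be an inversion and r = t(i) < j.  If α(r) < α(j) then i < r < j is
-- a 312 pattern, so α(r) > α(j) and (r , j) is an inversion with a shorter
-- gap; by induction j = t^k(r) = t^(k+1)(i).  Finally i ≠ 1 because α(1) = 1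
-- is the smallest value.

open import Defs
open import Data.Nat using (ℕ; zero; suc; _+_; _∸_; _≤_; _<_; _<?_; z≤n; s≤s)
open import Data.Nat.Properties
open import Data.Nat.Induction using (<-wellFounded)
open import Data.Fin using (toℕ; fromℕ<)
open import Data.Fin.Properties using (toℕ-injective; fromℕ<-injective)
open import Data.Fin.Permutation using (Permutation′; _⟨$⟩ʳ_)
open import Data.Product using (_×_; ∃-syntax; _,_; proj₁; proj₂)
open import Data.Sum using (inj₁; inj₂)
open import Function.Base using (_∘_)
open import Function.Bundles using (_⇔_; mk⇔; Injection)
open import Function.Properties.Inverse using (↔⇒↣)
open import Induction.WellFounded using (Acc; acc)
open import Relation.Nullary using (yes; no; contradiction)
open import Relation.Binary using (tri<; tri≈; tri>)
open import Relation.Binary.PropositionalEquality using (_≡_; refl; sym; trans; cong; subst)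

iter-suc : ∀ (f : ℕ → ℕ) k x → iter f (suc k) x ≡ iter f k (f x)
iter-suc f zero    x = refl
iter-suc f (suc k) x = cong f (iter-suc f k x)

module _ {n : ℕ} (π : Permutation′ n) where

  val-suc : ∀ a (a<n : a < n) → val π (suc a) ≡ suc (toℕ (π ⟨$⟩ʳ fromℕ< a<n))
  val-suc a a<n with a <? n
  ... | yes _   = refl
  ... | no  a≮n = contradiction a<n a≮n

  val-positive : ∀ {j} → 1 ≤ j → j ≤ n → 1 ≤ val π j
  val-positive {suc a} _ a<n rewrite val-suc a a<n = s≤s z≤n

  val-injective : ∀ {a b} → 1 ≤ a → a ≤ n → 1 ≤ b → b ≤ n → val π a ≡ val π b → a ≡ b
  val-injective {suc a} {suc b} _ a<n _ b<n eq
    rewrite val-suc a a<n | val-suc b b<n =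
    cong suc (fromℕ<-injective a b a<n b<n
      (Injection.injective (↔⇒↣ π) (toℕ-injective (suc-injective eq))))

  firstBelow-found : ∀ v fuel l → firstBelow π v fuel l ≤ n →
                     l ≤ firstBelow π v fuel l × val π (firstBelow π v fuel l) < v
  firstBelow-found v zero l n<n = contradiction n<n (n≮n n)
  firstBelow-found v (suc fuel) l found with val π l <? v
  ... | yes below = ≤-refl , below
  ... | no  _     with firstBelow-found v fuel (suc l) found
  ...   | l<found , below = <⇒≤ l<found , below

  firstBelow-least : ∀ v fuel l m → l ≤ m → m < l + fuel → val π m < v →
                     firstBelow π v fuel l ≤ m
  firstBelow-least v zero l m l≤m m<l+0 _ =
    contradiction (subst (l <_) (+-identityʳ l) (≤-<-trans l≤m m<l+0)) (n≮n l)
  firstBelow-least v (suc fuel) l m l≤m m<end below with val π l <? v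
  ... | yes _ = l≤m
  ... | no l≮v with m ≟ l
  ...   | yes refl = contradiction below l≮v
  ...   | no  m≢l  = firstBelow-least v fuel (suc l) m
                       (≤∧≢⇒< l≤m (m≢l ∘ sym)) (subst (m <_) (+-suc l fuel) m<end) below

  t-found : ∀ {i} → t π i ≤ n → i < t π i × val π (t π i) < val π i
  t-found {i} t≤n with i <? suc n
  ... | no  _ = contradiction t≤n (n≮n n)
  ... | yes _ = firstBelow-found (val π i) (n ∸ i) (suc i) t≤n

  t-inv : ∀ {i} → 1 ≤ i → t π i ≤ n → Inv π i (t π i)
  t-inv 1≤i t≤n with t-found t≤n
  ... | i<t , below = 1≤i , i<t , t≤n , below

  t-least : ∀ {i j} → Inv π i j → t π i ≤ j
  t-least {i} {j} (_ , i<j , j≤n , below) with i <? suc n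
  ... | no  i≮1+n = contradiction (<-trans i<j (s≤s j≤n)) i≮1+n
  ... | yes _     = firstBelow-least (val π i) (n ∸ i) (suc i) j i<j j<end below
    where
    j<end : j < suc i + (n ∸ i)
    j<end = s≤s (subst (j ≤_) (sym (m+[n∸m]≡n (≤-trans (<⇒≤ i<j) j≤n))) j≤n)

  Inv⇒Inv-t : ∀ {i j} → Inv π i j → Inv π i (t π i)
  Inv⇒Inv-t inv@(1≤i , _ , j≤n , _) = t-inv 1≤i (≤-trans (t-least inv) j≤n)

  Inv-trans : ∀ {a b c} → Inv π a b → Inv π b c → Inv π a c
  Inv-trans (1≤a , a<b , _ , vb<va) (_ , b<c , c≤n , vc<vb) =
    1≤a , <-trans a<b b<c , c≤n , <-trans vc<vb vb<va

  Inv-iter-t : ∀ {i} k → 1 ≤ i → iter (t π) (suc k) i ≤ n → Inv π i (iter (t π) (suc k) i)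
  Inv-iter-t zero    1≤i t≤n = t-inv 1≤i t≤n
  Inv-iter-t {i} (suc k) 1≤i tᵏ⁺²≤n = Inv-trans inv-m (t-inv 1≤m tᵏ⁺²≤n)
    where
    m = iter (t π) (suc k) i
    inv-m : Inv π i m
    inv-m = Inv-iter-t k 1≤i (<⇒≤ (<-≤-trans (proj₁ (t-found tᵏ⁺²≤n)) tᵏ⁺²≤n))
    1≤m : 1 ≤ m
    1≤m = ≤-trans 1≤i (<⇒≤ (proj₁ (proj₂ inv-m)))

  Inv⇒2≤source : FixesOne π → ∀ {i j} → Inv π i j → 2 ≤ i
  Inv⇒2≤source α1≡1 {suc zero} {j} (_ , 1<j , j≤n , vj<α1) =
    contradiction (val-positive (<⇒≤ 1<j) j≤n) (<⇒≱ (subst (val π j <_) α1≡1 vj<α1))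
  Inv⇒2≤source α1≡1 {suc (suc _)} _ = s≤s (s≤s z≤n)

  module _ (avoids : Avoids312 π) where

    Inv⇒Inv-from-t : ∀ {i j} → Inv π i j → t π i < j → Inv π (t π i) j
    Inv⇒Inv-from-t {i} {j} inv@(1≤i , _ , j≤n , vj<vi) r<j
      with Inv⇒Inv-t inv | <-cmp (val π (t π i)) (val π j)
    ... | _ , i<r , _ , _ | tri< vr<vj _ _ =
      contradiction (i , t π i , j , 1≤i , i<r , r<j , j≤n , vr<vj , vj<vi) avoids
    ... | _ , i<r , r≤n , _ | tri≈ _ vr≡vj _ =
      contradiction (val-injective 1≤r r≤n (≤-trans 1≤r (<⇒≤ r<j)) j≤n vr≡vj) (<⇒≢ r<j)
      where 1≤r = ≤-trans 1≤i (<⇒≤ i<r)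
    ... | _ , i<r , _ , _ | tri> _ _ vj<vr = ≤-trans 1≤i (<⇒≤ i<r) , r<j , j≤n , vj<vr

    Inv⇒iter-t : ∀ {i j} → Inv π i j → ∃[ k ] (1 ≤ k × iter (t π) k i ≡ j)
    Inv⇒iter-t = go (<-wellFounded _)
      where
      go : ∀ {i j} → Acc _<_ (j ∸ i) → Inv π i j → ∃[ k ] (1 ≤ k × iter (t π) k i ≡ j)
      go {i} {j} (acc smaller) inv with m≤n⇒m<n∨m≡n (t-least inv)
      ... | inj₂ r≡j = 1 , ≤-refl , r≡j
      ... | inj₁ r<j with go (smaller gap-shrinks) (Inv⇒Inv-from-t inv r<j)
        where
        gap-shrinks : j ∸ t π i < j ∸ i
        gap-shrinks = ∸-monoʳ-< (proj₁ (proj₂ (Inv⇒Inv-t inv))) (<⇒≤ r<j)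
      ...   | k , _ , tᵏr≡j = suc k , s≤s z≤n , trans (iter-suc (t π) k i) tᵏr≡j

mainTheorem19 : (n : ℕ) → 1 ≤ n → (π : Permutation′ n) → FixesOne π → Avoids312 π →
    (i j : ℕ) → Inv π i j ⇔ (2 ≤ i × i ≤ n × j ≤ n × ∃[ k ] (1 ≤ k × iter (t π) k i ≡ j))
mainTheorem19 n _ π α1≡1 avoids i j = mk⇔ to from
  where
  to : Inv π i j → 2 ≤ i × i ≤ n × j ≤ n × ∃[ k ] (1 ≤ k × iter (t π) k i ≡ j)
  to inv@(_ , i<j , j≤n , _) =
    Inv⇒2≤source π α1≡1 inv , ≤-trans (<⇒≤ i<j) j≤n , j≤n , Inv⇒iter-t π avoids inv

  from : 2 ≤ i × i ≤ n × j ≤ n × ∃[ k ] (1 ≤ k × iter (t π) k i ≡ j) → Inv π i j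
  from (2≤i , _ , j≤n , suc k , _ , tᵏ⁺¹i≡j) =
    subst (Inv π i) tᵏ⁺¹i≡j
      (Inv-iter-t π k (≤-trans (s≤s z≤n) 2≤i) (subst (_≤ n) (sym tᵏ⁺¹i≡j) j≤n))
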